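{- For $1 \le i \le n$ let $S_i = (I_i\ i)$, where the $I_i$ are independent and $I_i$ is uniformly distributed on $\{1,\dots,i\}$ (with $(i\ i)$ the identity). Then for any $i, j \in \{1,\dots,n\}$, the random permutations $S_iS_j$ and $S_jS_i$ are identically distributed.
   Context: Random permutations are random variables valued in the symmetric group on $\{1,\dots,n\}$; products are compositions of permutations; $(j\ i)$ denotes the transposition of $j$ and $i$. -}

module Defs where

open import Data.Nat using (ℕ; zero; suc)
open import Data.Fin using (Fin; zero; suc; toℕ; inject≤)
open import Data.Fin.Properties using (toℕ<n; all?; _≟_)
open import Data.Fin.Permutation using (Permutation; Permutation′; transpose; _∘ₚ_; _⟨$⟩ʳ_)
open import Data.List using (List; []; _∷_; map; concatMap; length; filter; allFin)
open import Relation.Binary.PropositionalEquality using (_≡_)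
open import Relation.Nullary using (Dec)
open import Function using (_∘_)

-- Product of permutations = composition: (σ · τ)(x) = σ (τ x)
_·_ : ∀ {n} → Permutation′ n → Permutation′ n → Permutation′ n
σ · τ = τ ∘ₚ σ

consDep : ∀ {n} {B : Fin (suc n) → ℕ} → Fin (B zero) → ((k : Fin n) → Fin (B (suc k))) →
          (k : Fin (suc n)) → Fin (B k)
consDep a f zero    = a
consDep a f (suc k) = f k

allDep : (n : ℕ) (B : Fin n → ℕ) → List ((k : Fin n) → Fin (B k))
allDep zero    B = (λ ()) ∷ []
allDep (suc n) B =
  concatMap (λ a → map (consDep {B = B} a) (allDep n (B ∘ suc))) (allFin (B zero))

-- Sample space: outcomes ω of (I_1,…,I_n), 0-indexed: the index k : Fin n stands for
-- i = k+1, and ω k : Fin (k+1) stands for I_i - 1 ∈ {0,…,k}.  The product of the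
-- uniform distributions (independence) is the uniform distribution on Ω n.
Ω : ℕ → Set
Ω n = (k : Fin n) → Fin (suc (toℕ k))

outcomes : (n : ℕ) → List (Ω n)
outcomes n = allDep n (λ k → suc (toℕ k))

I : ∀ {n} → Ω n → Fin n → Fin n
I ω k = inject≤ (ω k) (toℕ<n k)

S : ∀ {n} → Ω n → Fin n → Permutation′ n
S ω k = transpose (I ω k) k

-- Number of outcomes ω on which the random permutation X takes the value σ
-- (probability = this count divided by n!, the size of Ω n).
count : ∀ {n} → (Ω n → Permutation′ n) → Permutation′ n → ℕ
count {n} X σ = length (filter (λ ω → all? (λ x → X ω ⟨$⟩ʳ x ≟ σ ⟨$⟩ʳ x)) (outcomes n))

IdentDist : ∀ {n} → (Ω n → Permutation′ n) → (Ω n → Permutation′ n) → Set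
IdentDist X Y = ∀ σ → count X σ ≡ count Y σ

-- For i < j we have I_i ≤ i < j, so the transposition τ = (I_i i) fixes j and maps
-- {1,…,j} onto itself.  Conjugating by τ gives (b j) τ = τ (τb j), hence
-- S_j S_i = S_i (τ I_j  j).  For each fixed value of I_i, b ↦ τ b is a bijection of
-- {1,…,j}, and I_j is uniform on {1,…,j} independently of I_i; so replacing I_j by
-- τ I_j does not change the distribution, and S_j S_i has the law of S_i S_j.
module Submission where

open import Data.Nat using (ℕ; zero; suc; _+_; _*_; _≤_; s≤s; s≤s⁻¹)
import Data.Nat.Properties as ℕₚ
open import Data.Fin using (Fin; zero; suc; toℕ; inject≤; fromℕ<; _<_)
open import Data.Fin.Properties
  using (toℕ<n; all?; _≟_; <-cmp; toℕ-injective; toℕ-inject≤; toℕ-fromℕ<; inject≤-injective;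
         inject≤-idempotent)
open import Data.Fin.Permutation using (Permutation′; transpose; _⟨$⟩ʳ_; _≈_)
open import Data.Fin.Permutation.Components using () renaming (transpose to swap)
open import Data.List using (List; []; _∷_; _++_; map; concatMap; length; filter; allFin; tabulate)
open import Data.Nat.ListAction using (sum)
open import Data.Nat.ListAction.Properties using (sum-++)
open import Data.List.Properties using (map-++; map-∘; map-tabulate)
open import Data.Bool using (true; false; if_then_else_)
open import Relation.Nullary using (Dec; yes; no; does)
open import Relation.Nullary.Decidable using (dec-true; dec-false; does-⇔)
open import Relation.Binary using (tri<; tri≈; tri>)
open import Relation.Binary.PropositionalEquality
open import Function using (_∘_; _⇔_; mk⇔)
open import Function.Definitions using (Injective)
open import Algebra.Properties.Semiring.Sum ℕₚ.+-*-semiring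
  using (sum-syntax; sum-permute; sum-cong-≗; *-distribʳ-sum) renaming (sum to ∑)
open import Defs

private variable
  m n : ℕ

swap-matchˡ : (p q : Fin n) → swap p q p ≡ q
swap-matchˡ p q rewrite dec-true (p ≟ p) refl = refl

swap-matchʳ : (p q : Fin n) → swap p q q ≡ p
swap-matchʳ p q with q ≟ p
... | yes refl = refl
... | no _ rewrite dec-true (q ≟ q) refl = refl

swap-fix : {p q k : Fin n} → k ≢ p → k ≢ q → swap p q k ≡ k
swap-fix {p = p} {q} {k} k≢p k≢q rewrite dec-false (k ≟ p) k≢p | dec-false (k ≟ q) k≢q = refl

swap-involutive : (p q k : Fin n) → swap p q (swap p q k) ≡ k
swap-involutive p q k = cases (k ≟ p) (k ≟ q)
  where
  cases : Dec (k ≡ p) → Dec (k ≡ q) → swap p q (swap p q k) ≡ k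
  cases (yes refl) _          = trans (cong (swap k q) (swap-matchˡ k q)) (swap-matchʳ k q)
  cases (no _)     (yes refl) = trans (cong (swap p k) (swap-matchʳ p k)) (swap-matchˡ p k)
  cases (no k≢p)   (no k≢q)   = trans (cong (swap p q) (swap-fix k≢p k≢q)) (swap-fix k≢p k≢q)

swap-injective : (p q : Fin n) → Injective _≡_ _≡_ (swap p q)
swap-injective p q {x} {y} eq =
  trans (sym (swap-involutive p q x)) (trans (cong (swap p q) eq) (swap-involutive p q y))

swap-natural : (e : Fin m → Fin n) → Injective _≡_ _≡_ e →
               (p q x : Fin m) → e (swap p q x) ≡ swap (e p) (e q) (e x)
swap-natural e e-inj p q x = cases (x ≟ p) (x ≟ q)
  where
  cases : Dec (x ≡ p) → Dec (x ≡ q) → e (swap p q x) ≡ swap (e p) (e q) (e x)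
  cases (yes refl) _          = trans (cong e (swap-matchˡ x q)) (sym (swap-matchˡ (e x) (e q)))
  cases (no _)     (yes refl) = trans (cong e (swap-matchʳ p x)) (sym (swap-matchʳ (e p) (e x)))
  cases (no x≢p)   (no x≢q)   =
    trans (cong e (swap-fix x≢p x≢q)) (sym (swap-fix (x≢p ∘ e-inj) (x≢q ∘ e-inj)))

transpose-·-transpose : {p q c d : Fin n} → d ≢ p → d ≢ q →
  transpose c d · transpose p q ≈ transpose p q · transpose (swap p q c) d
transpose-·-transpose {p = p} {q} {c} {d} d≢p d≢q x = sym (begin
  τ (swap (τ c) d x)          ≡⟨ swap-natural τ (swap-injective p q) (τ c) d x ⟩
  swap (τ (τ c)) (τ d) (τ x)  ≡⟨ cong₂ (λ c′ d′ → swap c′ d′ (τ x)) (swap-involutive p q c) (swap-fix d≢p d≢q) ⟩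
  swap c d (τ x)              ∎)
  where
  open ≡-Reasoning
  τ : Fin _ → Fin _
  τ = swap p q

inject≤-swap : .(le : m ≤ n) (p q x : Fin m) →
  inject≤ (swap p q x) le ≡ swap (inject≤ p le) (inject≤ q le) (inject≤ x le)
inject≤-swap le = swap-natural (λ x → inject≤ x le) (inject≤-injective le le _ _)

sumDep : (n : ℕ) (B : Fin n → ℕ) → (((k : Fin n) → Fin (B k)) → ℕ) → ℕ
sumDep n B h = sum (map h (allDep n B))

sum-map-concatMap : {A C : Set} (h : C → ℕ) (g : A → List C) (xs : List A) →
  sum (map h (concatMap g xs)) ≡ sum (map (λ a → sum (map h (g a))) xs)
sum-map-concatMap h g []       = refl
sum-map-concatMap h g (x ∷ xs) = begin
  sum (map h (g x ++ concatMap g xs))                  ≡⟨ cong sum (map-++ h (g x) (concatMap g xs)) ⟩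
  sum (map h (g x) ++ map h (concatMap g xs))          ≡⟨ sum-++ (map h (g x)) (map h (concatMap g xs)) ⟩
  sum (map h (g x)) + sum (map h (concatMap g xs))     ≡⟨ cong (sum (map h (g x)) +_) (sum-map-concatMap h g xs) ⟩
  sum (map h (g x)) + sum (map (λ a → sum (map h (g a))) xs) ∎
  where open ≡-Reasoning

sum-tabulate : (f : Fin n → ℕ) → sum (tabulate f) ≡ ∑ f
sum-tabulate {zero}  f = refl
sum-tabulate {suc n} f = cong (f zero +_) (sum-tabulate (f ∘ suc))

sum-map-const : {A : Set} (c : ℕ) (xs : List A) → sum (map (λ _ → c) xs) ≡ c * length xs
sum-map-const c []       = sym (ℕₚ.*-zeroʳ c)
sum-map-const c (x ∷ xs) = trans (cong (c +_) (sum-map-const c xs)) (sym (ℕₚ.*-suc c (length xs)))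

sumDep-suc : (n : ℕ) (B : Fin (suc n) → ℕ) (h : ((k : Fin (suc n)) → Fin (B k)) → ℕ) →
  sumDep (suc n) B h ≡ ∑ (λ a → sumDep n (B ∘ suc) (h ∘ consDep a))
sumDep-suc n B h = begin
  sum (map h (concatMap (λ a → map (consDep a) rest) (allFin (B zero))))
    ≡⟨ sum-map-concatMap h (λ a → map (consDep a) rest) (allFin (B zero)) ⟩
  sum (map (λ a → sum (map h (map (consDep a) rest))) (tabulate (λ a → a)))
    ≡⟨ cong sum (map-tabulate (λ a → a) (λ a → sum (map h (map (consDep a) rest)))) ⟩
  sum (tabulate (λ a → sum (map h (map (consDep a) rest))))
    ≡⟨ sum-tabulate (λ a → sum (map h (map (consDep a) rest))) ⟩
  ∑ (λ a → sum (map h (map (consDep a) rest)))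
    ≡⟨ sum-cong-≗ (λ a → cong sum (sym (map-∘ {g = h} {f = consDep a} rest))) ⟩
  ∑ (λ a → sumDep n (B ∘ suc) (h ∘ consDep a)) ∎
  where
  open ≡-Reasoning
  rest : List ((k : Fin n) → Fin (B (suc k)))
  rest = allDep n (B ∘ suc)

sumDep-cong-at : (n : ℕ) (B : Fin n → ℕ) (j : Fin n) (G G′ : Fin (B j) → ℕ) → ∑ G ≡ ∑ G′ →
  sumDep n B (λ ω → G (ω j)) ≡ sumDep n B (λ ω → G′ (ω j))
sumDep-cong-at (suc n) B zero G G′ eq = begin
  sumDep (suc n) B (λ ω → G (ω zero))   ≡⟨ sumDep-suc n B _ ⟩
  ∑ (λ a → sum (map (λ _ → G a) rest))  ≡⟨ sum-cong-≗ (λ a → sum-map-const (G a) rest) ⟩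
  ∑ (λ a → G a * length rest)           ≡⟨ *-distribʳ-sum (length rest) G ⟨
  ∑ G * length rest                     ≡⟨ cong (_* length rest) eq ⟩
  ∑ G′ * length rest                    ≡⟨ *-distribʳ-sum (length rest) G′ ⟩
  ∑ (λ a → G′ a * length rest)          ≡⟨ sum-cong-≗ (λ a → sum-map-const (G′ a) rest) ⟨
  ∑ (λ a → sum (map (λ _ → G′ a) rest)) ≡⟨ sumDep-suc n B _ ⟨
  sumDep (suc n) B (λ ω → G′ (ω zero))  ∎
  where
  open ≡-Reasoning
  rest : List ((k : Fin n) → Fin (B (suc k)))
  rest = allDep n (B ∘ suc)
sumDep-cong-at (suc n) B (suc j) G G′ eq = begin
  sumDep (suc n) B (λ ω → G (ω (suc j)))                ≡⟨ sumDep-suc n B _ ⟩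
  ∑[ a < B zero ] sumDep n (B ∘ suc) (λ ω → G (ω j))   ≡⟨ sum-cong-≗ {B zero} (λ _ → sumDep-cong-at n (B ∘ suc) j G G′ eq) ⟩
  ∑[ a < B zero ] sumDep n (B ∘ suc) (λ ω → G′ (ω j))  ≡⟨ sumDep-suc n B _ ⟨
  sumDep (suc n) B (λ ω → G′ (ω (suc j)))               ∎
  where open ≡-Reasoning

-- Once the earlier coordinate ω i = a is fixed, only ω j varies: this is sumDep-cong-at.
sumDep-cong-at₂ : (n : ℕ) (B : Fin n → ℕ) (i j : Fin n) → i < j →
  (H H′ : Fin (B i) → Fin (B j) → ℕ) → (∀ a → ∑ (H a) ≡ ∑ (H′ a)) →
  sumDep n B (λ ω → H (ω i) (ω j)) ≡ sumDep n B (λ ω → H′ (ω i) (ω j))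
sumDep-cong-at₂ (suc n) B zero (suc j) _ H H′ eq = begin
  sumDep (suc n) B (λ ω → H (ω zero) (ω (suc j)))        ≡⟨ sumDep-suc n B _ ⟩
  ∑[ a < B zero ] sumDep n (B ∘ suc) (λ ω → H a (ω j))   ≡⟨ sum-cong-≗ (λ a → sumDep-cong-at n (B ∘ suc) j (H a) (H′ a) (eq a)) ⟩
  ∑[ a < B zero ] sumDep n (B ∘ suc) (λ ω → H′ a (ω j))  ≡⟨ sumDep-suc n B _ ⟨
  sumDep (suc n) B (λ ω → H′ (ω zero) (ω (suc j)))       ∎
  where open ≡-Reasoning
sumDep-cong-at₂ (suc n) B (suc i) (suc j) (s≤s i<j) H H′ eq = begin
  sumDep (suc n) B (λ ω → H (ω (suc i)) (ω (suc j)))       ≡⟨ sumDep-suc n B _ ⟩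
  ∑[ a < B zero ] sumDep n (B ∘ suc) (λ ω → H (ω i) (ω j))   ≡⟨ sum-cong-≗ {B zero} (λ _ → sumDep-cong-at₂ n (B ∘ suc) i j i<j H H′ eq) ⟩
  ∑[ a < B zero ] sumDep n (B ∘ suc) (λ ω → H′ (ω i) (ω j))  ≡⟨ sumDep-suc n B _ ⟨
  sumDep (suc n) B (λ ω → H′ (ω (suc i)) (ω (suc j)))      ∎
  where open ≡-Reasoning

𝟙 : {P : Set} → Dec P → ℕ
𝟙 P? = if does P? then 1 else 0

length-filter≡sum-𝟙 : {A : Set} {P : A → Set} (P? : ∀ x → Dec (P x)) (xs : List A) →
  length (filter P? xs) ≡ sum (map (λ x → 𝟙 (P? x)) xs)
length-filter≡sum-𝟙 P? []       = refl
length-filter≡sum-𝟙 P? (x ∷ xs) with does (P? x)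
... | true  = cong suc (length-filter≡sum-𝟙 P? xs)
... | false = length-filter≡sum-𝟙 P? xs

infix 4 _≟ₚ_
_≟ₚ_ : (π ρ : Permutation′ n) → Dec (π ≈ ρ)
π ≟ₚ ρ = all? (λ x → π ⟨$⟩ʳ x ≟ ρ ⟨$⟩ʳ x)

𝟙-≟ₚ-congˡ : {π π′ : Permutation′ n} → π ≈ π′ → (σ : Permutation′ n) → 𝟙 (π ≟ₚ σ) ≡ 𝟙 (π′ ≟ₚ σ)
𝟙-≟ₚ-congˡ {π = π} {π′} π≈π′ σ = cong (λ b → if b then 1 else 0) (does-⇔ π≈σ⇔π′≈σ (π ≟ₚ σ) (π′ ≟ₚ σ))
  where
  π≈σ⇔π′≈σ : π ≈ σ ⇔ π′ ≈ σ
  π≈σ⇔π′≈σ = mk⇔ (λ π≈σ x → trans (sym (π≈π′ x)) (π≈σ x)) (λ π′≈σ x → trans (π≈π′ x) (π′≈σ x))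

count≡sumDep : (X : Ω n → Permutation′ n) (σ : Permutation′ n) →
  count X σ ≡ sumDep n (λ k → suc (toℕ k)) (λ ω → 𝟙 (X ω ≟ₚ σ))
count≡sumDep {n} X σ = length-filter≡sum-𝟙 _ (outcomes n)

identDist-S·S-< : {i j : Fin n} → i < j → IdentDist (λ ω → S ω i · S ω j) (λ ω → S ω j · S ω i)
identDist-S·S-< {n} {i} {j} i<j σ = begin
  count (λ ω → S ω i · S ω j) σ       ≡⟨ count≡sumDep (λ ω → S ω i · S ω j) σ ⟩
  sumDep n B (λ ω → H (ω i) (ω j))   ≡⟨ sumDep-cong-at₂ n B i j i<j H H′ reindex ⟩
  sumDep n B (λ ω → H′ (ω i) (ω j))  ≡⟨ count≡sumDep (λ ω → S ω j · S ω i) σ ⟨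
  count (λ ω → S ω j · S ω i) σ       ∎
  where
  open ≡-Reasoning
  B : Fin n → ℕ
  B k = suc (toℕ k)
  ι : (k : Fin n) → Fin (B k) → Fin n
  ι k b = inject≤ b (toℕ<n k)
  SiSj SjSi : Fin (B i) → Fin (B j) → Permutation′ n
  SiSj a b = transpose (ι i a) i · transpose (ι j b) j
  SjSi a b = transpose (ι j b) j · transpose (ι i a) i
  H H′ : Fin (B i) → Fin (B j) → ℕ
  H  a b = 𝟙 (SiSj a b ≟ₚ σ)
  H′ a b = 𝟙 (SjSi a b ≟ₚ σ)

  Bi≤Bj : B i ≤ B j
  Bi≤Bj = ℕₚ.m≤n⇒m≤1+n i<j
  i′ : Fin (B j)
  i′ = fromℕ< Bi≤Bj
  ι-i′ : ι j i′ ≡ i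
  ι-i′ = toℕ-injective (trans (toℕ-inject≤ i′ (toℕ<n j)) (toℕ-fromℕ< Bi≤Bj))
  ι-inject≤ : (a : Fin (B i)) → ι j (inject≤ a Bi≤Bj) ≡ ι i a
  ι-inject≤ a = inject≤-idempotent a Bi≤Bj (toℕ<n j) (toℕ<n i)

  j≢ι : (a : Fin (B i)) → j ≢ ι i a
  j≢ι a j≡ιa = ℕₚ.<⇒≱ i<j (subst (_≤ toℕ i)
    (trans (sym (toℕ-inject≤ a (toℕ<n i))) (cong toℕ (sym j≡ιa))) (s≤s⁻¹ (toℕ<n a)))
  j≢i : j ≢ i
  j≢i j≡i = ℕₚ.<⇒≢ i<j (cong toℕ (sym j≡i))

  ρ : Fin (B i) → Permutation′ (B j)
  ρ a = transpose (inject≤ a Bi≤Bj) i′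
  ι-ρ : ∀ a b → ι j (ρ a ⟨$⟩ʳ b) ≡ swap (ι i a) i (ι j b)
  ι-ρ a b = trans (inject≤-swap (toℕ<n j) (inject≤ a Bi≤Bj) i′ b)
                  (cong₂ (λ p q → swap p q (ι j b)) (ι-inject≤ a) ι-i′)

  SjSi≈SiSj∘ρ : ∀ a b → SjSi a b ≈ SiSj a (ρ a ⟨$⟩ʳ b)
  SjSi≈SiSj∘ρ a b x = begin
    transpose (ι j b) j · transpose (ι i a) i ⟨$⟩ʳ x                   ≡⟨ transpose-·-transpose (j≢ι a) j≢i x ⟩
    transpose (ι i a) i · transpose (swap (ι i a) i (ι j b)) j ⟨$⟩ʳ x  ≡⟨ cong (λ c → (transpose (ι i a) i · transpose c j) ⟨$⟩ʳ x) (ι-ρ a b) ⟨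
    transpose (ι i a) i · transpose (ι j (ρ a ⟨$⟩ʳ b)) j ⟨$⟩ʳ x        ∎

  H′≡H∘ρ : ∀ a b → H′ a b ≡ H a (ρ a ⟨$⟩ʳ b)
  H′≡H∘ρ a b = 𝟙-≟ₚ-congˡ {π = SjSi a b} {SiSj a (ρ a ⟨$⟩ʳ b)} (SjSi≈SiSj∘ρ a b) σ

  reindex : ∀ a → ∑ (H a) ≡ ∑ (H′ a)
  reindex a = begin
    ∑ (H a)                      ≡⟨ sum-permute (H a) (ρ a) ⟩
    ∑ (λ b → H a (ρ a ⟨$⟩ʳ b))  ≡⟨ sum-cong-≗ (λ b → H′≡H∘ρ a b) ⟨
    ∑ (H′ a)                     ∎

corollary5p6 : (n : ℕ) (i j : Fin n) →
    IdentDist (λ ω → S ω i · S ω j) (λ ω → S ω j · S ω i)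
corollary5p6 n i j σ with <-cmp i j
... | tri< i<j _ _  = identDist-S·S-< i<j σ
... | tri≈ _ refl _ = refl
... | tri> _ _ j<i  = sym (identDist-S·S-< j<i σ)
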